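{- Let $\mathbb{A}$ be a DMBI algebra (respectively, CBI algebra). Then the map $\theta_{\mathbb{A}}:A\to Com(Pr(\mathbb{A}))$, $\theta_{\mathbb{A}}(a)=\{F\in Pr(\mathbb{A})\mid a\in F\}$, is an embedding of DMBI (CBI) algebras (injective and preserving $\top,\bot,\wedge,\vee,\to,*,\mathbin{ -\!\!*},\top^*,\bot^*$). Hence every DMBI (CBI) algebra is isomorphic to a subalgebra of a complex algebra.
   Context: BI algebra: $(A,\wedge,\vee,\to,\top,\bot,*,\mathbin{ -\!\!*},\top^*)$, Heyting reduct, $(A,*,\top^*)$ commutative monoid, $a*b\le c$ iff $a\le b\mathbin{ -\!\!*}c$; BBI: Boolean reduct. DMBI algebra: BI algebra with extra constant $\bot^*$ such that, with ${\sim}a:=a\mathbin{ -\!\!*}\bot^*$, ${\sim}{\sim}a=a$ and ${\sim}\top^*=\bot^*$; CBI algebra: DMBI algebra with BBI reduct. DMBI frame: $(X,\preccurlyeq,\circ,E,-)$ where $(X,\preccurlyeq,\circ,E)$ is a BI frame (preorder $\preccurlyeq$, $\circ:X^2\to\mathcal{P}(X)$, $E\subseteq X$, with Commutativity, Closure of $E$ upward, Unit Existence $\exists e\in E(x\in x\circ e)$, Coherence $e\in E\wedge x\in y\circ e\to x\succcurlyeq y$, Associativity $t'\succcurlyeq t\in x\circ y\wedge w\in t'\circ z\to\exists s,s',w'(s'\succcurlyeq s\in y\circ z\wedge w\succcurlyeq w'\in x\circ s')$) and $-:X\to X$ with $x\succcurlyeq y\to -y\succcurlyeq -x$, $--x=x$,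 $z\in x\circ y\to -x\in -z\circ y$. CBI frame: order is equality. Complex algebra of a DMBI frame: $Com(\mathcal{X})=(\mathcal{P}_{\succcurlyeq}(X),\cap,\cup,\Rightarrow,X,\emptyset,\bullet,\mathbin{ -\!\!\bullet},E,U)$ with upward-closed subsets, $A\Rightarrow B=\{x\mid\forall x'\succcurlyeq x(x'\in A\to x'\in B)\}$, $A\bullet B=\{x\mid\exists w,y,z(w\preccurlyeq x,w\in y\circ z,y\in A,z\in B)\}$, $A\mathbin{ -\!\!\bullet}B=\{x\mid\forall w,y,z(x\preccurlyeq w,z\in w\circ y,y\in A\Rightarrow z\in B)\}$, $\top^*$ interpreted as $E$ and $\bot^*$ as $U=\{x\mid -x\notin E\}$ (CBI: all subsets, $A\Rightarrow B=\overline{A}\cup B$, order equality). Prime filter frame: $Pr(\mathbb{A})=(Pr(\mathbb{A}),\subseteq,\circ_{\mathbb{A}},E_{\mathbb{A}},-_{\mathbb{A}})$: prime filters, $F\circ_{\mathbb{A}}F'=\{F''\mid\forall a\in F,b\in F':a*b\in F''\}$, $E_{\mathbb{A}}=\{F\mid\top^*\in F\}$, $-_{\mathbb{A}}F=\overline{\{{\sim}a\mid a\in F\}}$. -}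

module Defs where

open import Level using (Level; suc; _⊔_)
open import Data.Product using (Σ; ∃; _×_; _,_; proj₁; proj₂)
open import Data.Sum using (_⊎_)
open import Data.Empty using (⊥)
open import Relation.Nullary using (¬_)
open import Relation.Unary using (Pred; _⊆_; _≐_; _∩_; _∪_; ∁; ∅; U)
open import Relation.Binary.PropositionalEquality using (_≡_)
open import Axiom.ExcludedMiddle using (ExcludedMiddle)

module LatticeNotions {ℓ : Level} (C : Set ℓ) (_≤_ : C → C → Set ℓ)
                      (⊤ᴸ ⊥ᴸ : C) (_∧_ _∨_ : C → C → C) where

  record IsFilter (F : Pred C ℓ) : Set ℓ where
    field
      ⊤∈      : F ⊤ᴸ
      up      : ∀ {a b} → F a → a ≤ b → F b
      ∧-close : ∀ {a b} → F a → F b → F (a ∧ b)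

  record IsIdeal (I : Pred C ℓ) : Set ℓ where
    field
      ⊥∈      : I ⊥ᴸ
      down    : ∀ {a b} → I b → a ≤ b → I a
      ∨-close : ∀ {a b} → I a → I b → I (a ∨ b)

  record IsPrimeFilter (F : Pred C ℓ) : Set ℓ where
    field
      filter : IsFilter F
      proper : ¬ F ⊥ᴸ
      prime  : ∀ {a b} → F (a ∨ b) → F a ⊎ F b

-- Bounded distributive lattices (only used to state the prime filter
-- theorem as a choice principle)

record BDLattice (ℓ : Level) : Set (suc ℓ) where
  infix 4 _≤_
  infixr 7 _∧_
  infixr 6 _∨_
  field
    Carrier   : Set ℓ
    _≤_       : Carrier → Carrier → Set ℓ
    ≤-refl    : ∀ {a} → a ≤ a
    ≤-trans   : ∀ {a b c} → a ≤ b → b ≤ c → a ≤ c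
    ≤-antisym : ∀ {a b} → a ≤ b → b ≤ a → a ≡ b
    ⊤ᴸ ⊥ᴸ     : Carrier
    _∧_ _∨_   : Carrier → Carrier → Carrier
    ⊤-max     : ∀ a → a ≤ ⊤ᴸ
    ⊥-min     : ∀ a → ⊥ᴸ ≤ a
    ∧-lb₁     : ∀ a b → a ∧ b ≤ a
    ∧-lb₂     : ∀ a b → a ∧ b ≤ b
    ∧-glb     : ∀ {a b c} → c ≤ a → c ≤ b → c ≤ a ∧ b
    ∨-ub₁     : ∀ a b → a ≤ a ∨ b
    ∨-ub₂     : ∀ a b → b ≤ a ∨ b
    ∨-lub     : ∀ {a b c} → a ≤ c → b ≤ c → a ∨ b ≤ c
    distrib   : ∀ a b c → a ∧ (b ∨ c) ≤ (a ∧ b) ∨ (a ∧ c)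

PrimeFilterTheorem : (ℓ : Level) → Set (suc ℓ)
PrimeFilterTheorem ℓ =
  (L : BDLattice ℓ) → let open BDLattice L
                          open LatticeNotions Carrier _≤_ ⊤ᴸ ⊥ᴸ _∧_ _∨_ in
  (F I : Pred Carrier ℓ) → IsFilter F → IsIdeal I →
  (∀ a → F a → I a → ⊥) →
  Σ (Pred Carrier ℓ) λ P → IsPrimeFilter P × F ⊆ P × (∀ a → P a → I a → ⊥)

record BIAlgebra (ℓ : Level) : Set (suc ℓ) where
  infix 4 _≤_
  infixr 7 _∧_ _*_
  infixr 6 _∨_
  infixr 5 _⇨_ _-*_
  field
    Carrier   : Set ℓ
    _≤_       : Carrier → Carrier → Set ℓ
    ≤-refl    : ∀ {a} → a ≤ a
    ≤-trans   : ∀ {a b c} → a ≤ b → b ≤ c → a ≤ c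
    ≤-antisym : ∀ {a b} → a ≤ b → b ≤ a → a ≡ b
    ⊤ᴬ ⊥ᴬ     : Carrier
    _∧_ _∨_ _⇨_ : Carrier → Carrier → Carrier
    ⊤-max     : ∀ a → a ≤ ⊤ᴬ
    ⊥-min     : ∀ a → ⊥ᴬ ≤ a
    ∧-lb₁     : ∀ a b → a ∧ b ≤ a
    ∧-lb₂     : ∀ a b → a ∧ b ≤ b
    ∧-glb     : ∀ {a b c} → c ≤ a → c ≤ b → c ≤ a ∧ b
    ∨-ub₁     : ∀ a b → a ≤ a ∨ b
    ∨-ub₂     : ∀ a b → b ≤ a ∨ b
    ∨-lub     : ∀ {a b c} → a ≤ c → b ≤ c → a ∨ b ≤ c
    ⇨-res₁    : ∀ {a b c} → a ∧ b ≤ c → a ≤ b ⇨ c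
    ⇨-res₂    : ∀ {a b c} → a ≤ b ⇨ c → a ∧ b ≤ c
    _*_ _-*_  : Carrier → Carrier → Carrier
    ⊤*        : Carrier
    *-assoc   : ∀ a b c → (a * b) * c ≡ a * (b * c)
    *-comm    : ∀ a b → a * b ≡ b * a
    *-identityʳ : ∀ a → a * ⊤* ≡ a
    -*-res₁   : ∀ {a b c} → a * b ≤ c → a ≤ b -* c
    -*-res₂   : ∀ {a b c} → a ≤ b -* c → a * b ≤ c

record DMBIAlgebra (ℓ : Level) : Set (suc ℓ) where
  field
    bi : BIAlgebra ℓ
  open BIAlgebra bi public
  field
    ⊥* : Carrier
  ∼_ : Carrier → Carrier
  ∼ a = a -* ⊥*
  field
    ∼∼    : ∀ a → ∼ (∼ a) ≡ a
    ∼⊤*   : ∼ ⊤* ≡ ⊥*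

IsCBI : ∀ {ℓ} → DMBIAlgebra ℓ → Set ℓ
IsCBI 𝔸 = ∀ a → a ∨ (a ⇨ ⊥ᴬ) ≡ ⊤ᴬ
  where open DMBIAlgebra 𝔸

-- Complex-algebra operations on subsets of a frame (X, ≼, ∘)
-- R x y z  means  z ∈ x ∘ y

module ComplexOps {x r : Level} (X : Set x) (_≼_ : X → X → Set r)
                  (R : X → X → X → Set r) where

  UpClosed : ∀ {p} → Pred X p → Set (x ⊔ r ⊔ p)
  UpClosed S = ∀ {u v} → u ≼ v → S u → S v

  _⇒_ : ∀ {p q} → Pred X p → Pred X q → Pred X (x ⊔ r ⊔ p ⊔ q)
  (S ⇒ T) u = ∀ u' → u ≼ u' → S u' → T u'

  _•_ : ∀ {p q} → Pred X p → Pred X q → Pred X (x ⊔ r ⊔ p ⊔ q)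
  (S • T) u = ∃ λ w → ∃ λ y → ∃ λ z → w ≼ u × R y z w × S y × T z

  _-•_ : ∀ {p q} → Pred X p → Pred X q → Pred X (x ⊔ r ⊔ p ⊔ q)
  (S -• T) u = ∀ w y z → u ≼ w → R w y z → S y → T z

module PrimeFilterFrame {ℓ : Level} (𝔸 : DMBIAlgebra ℓ) where
  open DMBIAlgebra 𝔸
  open LatticeNotions Carrier _≤_ ⊤ᴬ ⊥ᴬ _∧_ _∨_ public

  PrimeFilter : Set (suc ℓ)
  PrimeFilter = Σ (Pred Carrier ℓ) IsPrimeFilter

  _⊑_ : PrimeFilter → PrimeFilter → Set ℓ
  F ⊑ G = proj₁ F ⊆ proj₁ G

  _≈F_ : PrimeFilter → PrimeFilter → Set ℓ
  F ≈F G = proj₁ F ≐ proj₁ G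

  R𝔸 : PrimeFilter → PrimeFilter → PrimeFilter → Set ℓ
  R𝔸 F F' F'' = ∀ a b → proj₁ F a → proj₁ F' b → proj₁ F'' (a * b)

  E𝔸 : Pred PrimeFilter ℓ
  E𝔸 F = proj₁ F ⊤*

  neg𝔸 : PrimeFilter → Pred Carrier ℓ
  neg𝔸 F c = ¬ (∃ λ a → proj₁ F a × c ≡ ∼ a)

  -- U = {F | -F ∉ E}, i.e. ⊤* ∉ -F
  U𝔸 : Pred PrimeFilter ℓ
  U𝔸 F = ¬ neg𝔸 F ⊤*

  θ : Carrier → Pred PrimeFilter ℓ
  θ a F = proj₁ F a

  record IsDMBIEmbedding : Set (suc ℓ) where
    open ComplexOps PrimeFilter _⊑_ R𝔸
    field
      θ-up      : ∀ a → UpClosed (θ a)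
      θ-inj     : ∀ a b → θ a ≐ θ b → a ≡ b
      θ-⊤       : θ ⊤ᴬ ≐ U
      θ-⊥       : θ ⊥ᴬ ≐ ∅
      θ-∧       : ∀ a b → θ (a ∧ b) ≐ (θ a ∩ θ b)
      θ-∨       : ∀ a b → θ (a ∨ b) ≐ (θ a ∪ θ b)
      θ-⇨       : ∀ a b → θ (a ⇨ b) ≐ (θ a ⇒ θ b)
      θ-*       : ∀ a b → θ (a * b) ≐ (θ a • θ b)
      θ--*      : ∀ a b → θ (a -* b) ≐ (θ a -• θ b)
      θ-⊤*      : θ ⊤* ≐ E𝔸
      θ-⊥*      : θ ⊥* ≐ U𝔸

  -- θ is an embedding of CBI algebras into the CBI complex algebra
  -- (all subsets, Boolean implication, frame order = equality of
  -- prime filters)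
  record IsCBIEmbedding : Set (suc ℓ) where
    open ComplexOps PrimeFilter _≈F_ R𝔸
    field
      θ-inj     : ∀ a b → θ a ≐ θ b → a ≡ b
      θ-⊤       : θ ⊤ᴬ ≐ U
      θ-⊥       : θ ⊥ᴬ ≐ ∅
      θ-∧       : ∀ a b → θ (a ∧ b) ≐ (θ a ∩ θ b)
      θ-∨       : ∀ a b → θ (a ∨ b) ≐ (θ a ∪ θ b)
      θ-⇨       : ∀ a b → θ (a ⇨ b) ≐ (∁ (θ a) ∪ θ b)
      θ-*       : ∀ a b → θ (a * b) ≐ (θ a • θ b)
      θ--*      : ∀ a b → θ (a -* b) ≐ (θ a -• θ b)
      θ-⊤*      : θ ⊤* ≐ E𝔸
      θ-⊥*      : θ ⊥* ≐ U𝔸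

module Submission where

-- Prime filters separate a ≰ b (extend ↑a away from ↓b), so θ is injective, and
-- primeness makes θ preserve the lattice operations.  The substance lies in
-- producing witnesses for *, -* and ⇨: each is a prime filter obtained by
-- extending a suitable filter away from an ideal.  To keep the frame relation
-- S · Y ⊆ G while growing Y, the ideal is {c | f * c ∉ G for some f ∈ S}, which
-- is closed under ∨ because G is prime and * distributes over ∨.

open import Defs
open import Level using (Level; suc)
open import Data.Product using (_×_; Σ; ∃; _,_; proj₁; proj₂)
open import Data.Sum using (inj₁; inj₂; [_,_]′)
open import Data.Empty using (⊥-elim)
open import Data.Unit using (tt)
open import Relation.Nullary using (¬_)
open import Relation.Unary using (Pred; _⊆_; _≐_; _∩_; _∪_; ∁; ∅; U)
open import Relation.Binary.PropositionalEquality using (_≡_; refl; sym; trans; subst; cong)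
open import Axiom.ExcludedMiddle using (ExcludedMiddle)
open import Axiom.DoubleNegationElimination using (DoubleNegationElimination; em⇒dne)

module BIAlgebraProperties {ℓ : Level} (A : BIAlgebra ℓ) where
  open BIAlgebra A

  ≡⇒≤ : ∀ {a b} → a ≡ b → a ≤ b
  ≡⇒≤ refl = ≤-refl

  ∧-comm-≤ : ∀ a b → a ∧ b ≤ b ∧ a
  ∧-comm-≤ a b = ∧-glb (∧-lb₂ a b) (∧-lb₁ a b)

  ∧-monoˡ-≤ : ∀ {a a'} b → a ≤ a' → a ∧ b ≤ a' ∧ b
  ∧-monoˡ-≤ b p = ∧-glb (≤-trans (∧-lb₁ _ b) p) (∧-lb₂ _ b)

  ⇨-eval : ∀ a b → a ∧ (a ⇨ b) ≤ b
  ⇨-eval a b = ≤-trans (∧-comm-≤ a (a ⇨ b)) (⇨-res₂ ≤-refl)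

  ∧-distribˡ-∨ : ∀ a b c → a ∧ (b ∨ c) ≤ (a ∧ b) ∨ (a ∧ c)
  ∧-distribˡ-∨ a b c = ≤-trans (∧-comm-≤ a (b ∨ c))
    (⇨-res₂ (∨-lub (⇨-res₁ (≤-trans (∧-comm-≤ b a) (∨-ub₁ _ _)))
                   (⇨-res₁ (≤-trans (∧-comm-≤ c a) (∨-ub₂ _ _)))))

  boundedDistributiveLattice : BDLattice ℓ
  boundedDistributiveLattice = record
    { Carrier = Carrier ; _≤_ = _≤_ ; ≤-refl = ≤-refl ; ≤-trans = ≤-trans
    ; ≤-antisym = ≤-antisym ; ⊤ᴸ = ⊤ᴬ ; ⊥ᴸ = ⊥ᴬ ; _∧_ = _∧_ ; _∨_ = _∨_
    ; ⊤-max = ⊤-max ; ⊥-min = ⊥-min ; ∧-lb₁ = ∧-lb₁ ; ∧-lb₂ = ∧-lb₂ ; ∧-glb = ∧-glb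
    ; ∨-ub₁ = ∨-ub₁ ; ∨-ub₂ = ∨-ub₂ ; ∨-lub = ∨-lub ; distrib = ∧-distribˡ-∨ }

  -*-eval : ∀ a b → (a -* b) * a ≤ b
  -*-eval a b = -*-res₂ ≤-refl

  *-monoˡ-≤ : ∀ {a a'} b → a ≤ a' → a * b ≤ a' * b
  *-monoˡ-≤ b p = -*-res₂ (≤-trans p (-*-res₁ ≤-refl))

  *-monoʳ-≤ : ∀ a {b b'} → b ≤ b' → a * b ≤ a * b'
  *-monoʳ-≤ a {b} {b'} p =
    ≤-trans (≡⇒≤ (*-comm a b)) (≤-trans (*-monoˡ-≤ a p) (≡⇒≤ (*-comm b' a)))

  *-distribʳ-∨ : ∀ a b c → (b ∨ c) * a ≤ b * a ∨ c * a
  *-distribʳ-∨ a b c = -*-res₂ (∨-lub (-*-res₁ (∨-ub₁ _ _)) (-*-res₁ (∨-ub₂ _ _)))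

  *-distribˡ-∨ : ∀ a b c → a * (b ∨ c) ≤ a * b ∨ a * c
  *-distribˡ-∨ a b c =
    ≤-trans (≡⇒≤ (*-comm a (b ∨ c))) (≤-trans (*-distribʳ-∨ a b c)
      (∨-lub (≤-trans (≡⇒≤ (*-comm b a)) (∨-ub₁ _ _))
             (≤-trans (≡⇒≤ (*-comm c a)) (∨-ub₂ _ _))))

  *-zeroʳ : ∀ a → a * ⊥ᴬ ≤ ⊥ᴬ
  *-zeroʳ a = ≤-trans (≡⇒≤ (*-comm a ⊥ᴬ)) (-*-res₂ (⊥-min _))

module BDLatticeFilters {ℓ : Level} (L : BDLattice ℓ) where
  open BDLattice L
  open LatticeNotions Carrier _≤_ ⊤ᴸ ⊥ᴸ _∧_ _∨_

  ↑-isFilter : ∀ a → IsFilter (a ≤_)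
  ↑-isFilter a = record { ⊤∈ = ⊤-max a ; up = ≤-trans ; ∧-close = ∧-glb }

  ↓-isIdeal : ∀ b → IsIdeal (_≤ b)
  ↓-isIdeal b = record { ⊥∈ = ⊥-min b ; down = λ p q → ≤-trans q p ; ∨-close = ∨-lub }

  ↑Image : (Carrier → Carrier) → Pred Carrier ℓ → Pred Carrier ℓ
  ↑Image φ S c = ∃ λ f → S f × φ f ≤ c

  ↑Image-isFilter : ∀ {φ S} → (∀ {x y} → x ≤ y → φ x ≤ φ y) → IsFilter S →
                    IsFilter (↑Image φ S)
  ↑Image-isFilter {φ} mono fS = record
    { ⊤∈ = ⊤ᴸ , IsFilter.⊤∈ fS , ⊤-max _
    ; up = λ { (f , sf , p) q → f , sf , ≤-trans p q }
    ; ∧-close = λ { (f , sf , p) (f' , sf' , p') →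
        f ∧ f' , IsFilter.∧-close fS sf sf' ,
        ∧-glb (≤-trans (mono (∧-lb₁ f f')) p) (≤-trans (mono (∧-lb₂ f f')) p') } }

  PrimeFilterᴸ : Set (suc ℓ)
  PrimeFilterᴸ = Σ (Pred Carrier ℓ) IsPrimeFilter

  primeFilter-avoiding : PrimeFilterTheorem ℓ → (S : Pred Carrier ℓ) → IsFilter S →
    ∀ {b} → ¬ S b → Σ PrimeFilterᴸ λ P → S ⊆ proj₁ P × ¬ proj₁ P b
  primeFilter-avoiding pft S fS {b} b∉S
    with pft L S (_≤ b) fS (↓-isIdeal b) (λ c sc c≤b → b∉S (IsFilter.up fS sc c≤b))
  ... | P , pP , S⊆P , disjoint = (P , pP) , S⊆P , λ pb → disjoint b pb ≤-refl

  ≤-by-primeFilters : PrimeFilterTheorem ℓ → DoubleNegationElimination ℓ → ∀ {a b} →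
    (∀ (P : PrimeFilterᴸ) → proj₁ P a → proj₁ P b) → a ≤ b
  ≤-by-primeFilters pft dne {a} {b} h = dne λ a≰b →
    let (P , ↑a⊆P , b∉P) = primeFilter-avoiding pft (a ≤_) (↑-isFilter a) a≰b
    in b∉P (h P (↑a⊆P ≤-refl))

module Representation {ℓ : Level} (dne : DoubleNegationElimination ℓ)
                      (pft : PrimeFilterTheorem ℓ) (𝔸 : DMBIAlgebra ℓ) where
  open DMBIAlgebra 𝔸
  open PrimeFilterFrame 𝔸
  open BIAlgebraProperties bi
  open BDLatticeFilters boundedDistributiveLattice
  open ComplexOps PrimeFilter _⊑_ R𝔸 using (_⇒_)

  module _ (F : PrimeFilter) where
    open IsPrimeFilter (proj₂ F) public using (proper; prime)
    open IsFilter (IsPrimeFilter.filter (proj₂ F)) public using (⊤∈; up; ∧-close)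

  Fuses : Pred Carrier ℓ → Pred Carrier ℓ → Pred Carrier ℓ → Set ℓ
  Fuses S T G = ∀ f c → S f → T c → G (f * c)

  Escaping : Pred Carrier ℓ → PrimeFilter → Pred Carrier ℓ
  Escaping S G c = ∃ λ f → S f × ¬ proj₁ G (f * c)

  Escaping-isIdeal : ∀ {S} → IsFilter S → (G : PrimeFilter) → IsIdeal (Escaping S G)
  Escaping-isIdeal {S} fS G = record
    { ⊥∈ = ⊤ᴬ , IsFilter.⊤∈ fS , λ g → proper G (up G g (*-zeroʳ ⊤ᴬ))
    ; down = λ { (f , sf , ng) q → f , sf , λ g → ng (up G g (*-monoʳ-≤ f q)) }
    ; ∨-close = λ { (f , sf , ng) (f' , sf' , ng') →
        f ∧ f' , IsFilter.∧-close fS sf sf' ,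
        λ g → [ ng , ng' ]′ (prime G (up G g (∧-∨-fusion f f' _ _))) } }
    where
    ∧-∨-fusion : ∀ f f' c c' → (f ∧ f') * (c ∨ c') ≤ f * c ∨ f' * c'
    ∧-∨-fusion f f' c c' = ≤-trans (*-distribˡ-∨ (f ∧ f') c c')
      (∨-lub (≤-trans (*-monoˡ-≤ c (∧-lb₁ f f')) (∨-ub₁ _ _))
             (≤-trans (*-monoˡ-≤ c' (∧-lb₂ f f')) (∨-ub₂ _ _)))

  -- If S · a ⊆ G, the filter ↑a can be grown to a prime Y with S · Y ⊆ G:
  -- separate ↑a from the ideal of elements that S fails to carry into G.
  fusion-extension : ∀ {S} → IsFilter S → (G : PrimeFilter) → ∀ a →
    (∀ f → S f → proj₁ G (f * a)) →
    Σ PrimeFilter λ Y → proj₁ Y a × Fuses S (proj₁ Y) (proj₁ G)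
  fusion-extension {S} fS G a h
    with pft boundedDistributiveLattice (a ≤_) (Escaping S G) (↑-isFilter a)
             (Escaping-isIdeal fS G)
             (λ { c a≤c (f , sf , ng) → ng (up G (h f sf) (*-monoʳ-≤ f a≤c)) })
  ... | Y , pY , ↑a⊆Y , disjoint =
    (Y , pY) , ↑a⊆Y ≤-refl , λ f c sf yc → dne λ ng → disjoint c yc (f , sf , ng)

  *-split : ∀ a b (F : PrimeFilter) → proj₁ F (a * b) →
    Σ PrimeFilter λ Y → Σ PrimeFilter λ Z → R𝔸 Y Z F × proj₁ Y a × proj₁ Z b
  *-split a b F ab∈F =
    let (Y , a∈Y , ↑b·Y⊆F) = fusion-extension (↑-isFilter b) F a
          (λ f b≤f → up F ab∈F (≤-trans (≡⇒≤ (*-comm a b)) (*-monoˡ-≤ a b≤f)))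
        (Z , b∈Z , Y·Z⊆F) = fusion-extension (IsPrimeFilter.filter (proj₂ Y)) F b
          (λ c c∈Y → subst (proj₁ F) (*-comm b c) (↑b·Y⊆F b c ≤-refl c∈Y))
    in Y , Z , Y·Z⊆F , a∈Y , b∈Z

  -*-refute : ∀ a b (F : PrimeFilter) → ¬ proj₁ F (a -* b) →
    Σ PrimeFilter λ Y → Σ PrimeFilter λ Z → R𝔸 F Y Z × proj₁ Y a × ¬ proj₁ Z b
  -*-refute a b F a-*b∉F =
    let (Z , F·a⊆Z , b∉Z) = primeFilter-avoiding pft (↑Image (_* a) (proj₁ F))
          (↑Image-isFilter (*-monoˡ-≤ a) (IsPrimeFilter.filter (proj₂ F)))
          (λ { (f , f∈F , fa≤b) → a-*b∉F (up F f∈F (-*-res₁ fa≤b)) })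
        (Y , a∈Y , F·Y⊆Z) = fusion-extension (IsPrimeFilter.filter (proj₂ F)) Z a
          (λ f f∈F → F·a⊆Z (f , f∈F , ≤-refl))
    in Y , Z , F·Y⊆Z , a∈Y , b∉Z

  ⇨-refute : ∀ a b (F : PrimeFilter) → ¬ proj₁ F (a ⇨ b) →
    Σ PrimeFilter λ P → F ⊑ P × proj₁ P a × ¬ proj₁ P b
  ⇨-refute a b F a⇨b∉F =
    let (P , F∧a⊆P , b∉P) = primeFilter-avoiding pft (↑Image (_∧ a) (proj₁ F))
          (↑Image-isFilter (∧-monoˡ-≤ a) (IsPrimeFilter.filter (proj₂ F)))
          (λ { (f , f∈F , f∧a≤b) → a⇨b∉F (up F f∈F (⇨-res₁ f∧a≤b)) })
    in P , (λ {c} c∈F → F∧a⊆P (c , c∈F , ∧-lb₁ c a))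
         , F∧a⊆P (⊤ᴬ , ⊤∈ F , ∧-lb₂ ⊤ᴬ a) , b∉P

  θ-injective : ∀ a b → θ a ≐ θ b → a ≡ b
  θ-injective a b (a⊆b , b⊆a) =
    ≤-antisym (≤-by-primeFilters pft dne λ P → a⊆b {P})
              (≤-by-primeFilters pft dne λ P → b⊆a {P})

  θ-⊤ᴬ : θ ⊤ᴬ ≐ U
  θ-⊤ᴬ = (λ _ → tt) , (λ {F} _ → ⊤∈ F)

  θ-⊥ᴬ : θ ⊥ᴬ ≐ ∅
  θ-⊥ᴬ = (λ {F} → proper F) , (λ ())

  θ-∧ : ∀ a b → θ (a ∧ b) ≐ (θ a ∩ θ b)
  θ-∧ a b = (λ {F} ab∈F → up F ab∈F (∧-lb₁ a b) , up F ab∈F (∧-lb₂ a b))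
          , (λ {F} (a∈F , b∈F) → ∧-close F a∈F b∈F)

  θ-∨ : ∀ a b → θ (a ∨ b) ≐ (θ a ∪ θ b)
  θ-∨ a b = (λ {F} → prime F)
          , (λ {F} → [ (λ a∈F → up F a∈F (∨-ub₁ a b)) , (λ b∈F → up F b∈F (∨-ub₂ a b)) ]′)

  θ-⊤* : θ ⊤* ≐ E𝔸
  θ-⊤* = (λ x → x) , (λ x → x)

  -- ⊥* = ∼ ⊤*, so ⊥* ∈ F  iff  ⊤* = ∼ a for some a ∈ F  iff  ⊤* ∉ -F.
  θ-⊥* : θ ⊥* ≐ U𝔸
  θ-⊥* = (λ ⊥*∈F ⊤*∉-F → ⊤*∉-F (⊥* , ⊥*∈F , ⊤*≡∼⊥*))
       , (λ {F} ⊤*∉-F → let (a , a∈F , ⊤*≡∼a) = dne ⊤*∉-F in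
            subst (proj₁ F) (trans (sym (∼∼ a)) (trans (cong ∼_ (sym ⊤*≡∼a)) ∼⊤*)) a∈F)
    where
    ⊤*≡∼⊥* : ⊤* ≡ ∼ ⊥*
    ⊤*≡∼⊥* = trans (sym (∼∼ ⊤*)) (cong ∼_ ∼⊤*)

  -- ≼ is ⊑ for the DMBI complex algebra and ≈F for the CBI one.
  module _ {_≼_ : PrimeFilter → PrimeFilter → Set ℓ}
           (≼-refl : ∀ {F} → F ≼ F) (≼⇒⊑ : ∀ {F G} → F ≼ G → F ⊑ G) where
    open ComplexOps PrimeFilter _≼_ R𝔸 using (_•_; _-•_)

    θ-* : ∀ a b → θ (a * b) ≐ (θ a • θ b)
    θ-* a b = (λ {F} ab∈F → let (Y , Z , Y·Z⊆F , a∈Y , b∈Z) = *-split a b F ab∈F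
                            in F , Y , Z , ≼-refl , Y·Z⊆F , a∈Y , b∈Z)
            , (λ { (W , Y , Z , W≼F , Y·Z⊆W , a∈Y , b∈Z) → ≼⇒⊑ W≼F (Y·Z⊆W a b a∈Y b∈Z) })

    θ--* : ∀ a b → θ (a -* b) ≐ (θ a -• θ b)
    θ--* a b = (λ { {F} a-*b∈F W Y Z F≼W W·Y⊆Z a∈Y →
                     up Z (W·Y⊆Z (a -* b) a (≼⇒⊑ F≼W a-*b∈F) a∈Y) (-*-eval a b) })
             , (λ {F} h → dne λ a-*b∉F →
                  let (Y , Z , F·Y⊆Z , a∈Y , b∉Z) = -*-refute a b F a-*b∉F
                  in b∉Z (h F Y Z ≼-refl F·Y⊆Z a∈Y))

  θ-⇨ : ∀ a b → θ (a ⇨ b) ≐ (θ a ⇒ θ b)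
  θ-⇨ a b = (λ a⇨b∈F P F⊑P a∈P → up P (∧-close P a∈P (F⊑P a⇨b∈F)) (⇨-eval a b))
          , (λ {F} h → dne λ a⇨b∉F →
               let (P , F⊑P , a∈P , b∉P) = ⇨-refute a b F a⇨b∉F
               in b∉P (h P F⊑P a∈P))

  θ-⇨-Boolean : IsCBI 𝔸 → ∀ a b → θ (a ⇨ b) ≐ (∁ (θ a) ∪ θ b)
  θ-⇨-Boolean boolean a b = (λ {F} → forward {F}) , (λ {F} → backward {F})
    where
    ¬a : Carrier
    ¬a = a ⇨ ⊥ᴬ

    a∨¬a∈ : ∀ F → proj₁ F (a ∨ ¬a)
    a∨¬a∈ F = subst (proj₁ F) (sym (boolean a)) (⊤∈ F)

    forward : θ (a ⇨ b) ⊆ (∁ (θ a) ∪ θ b)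
    forward {F} a⇨b∈F with prime F (a∨¬a∈ F)
    ... | inj₁ a∈F  = inj₂ (up F (∧-close F a∈F a⇨b∈F) (⇨-eval a b))
    ... | inj₂ ¬a∈F = inj₁ λ a∈F → proper F (up F (∧-close F a∈F ¬a∈F) (⇨-eval a ⊥ᴬ))

    backward : (∁ (θ a) ∪ θ b) ⊆ θ (a ⇨ b)
    backward {F} (inj₂ b∈F) = up F b∈F (⇨-res₁ (∧-lb₁ b a))
    backward {F} (inj₁ a∉F) with prime F (a∨¬a∈ F)
    ... | inj₁ a∈F  = ⊥-elim (a∉F a∈F)
    ... | inj₂ ¬a∈F =
      up F ¬a∈F (⇨-res₁ (≤-trans (∧-comm-≤ ¬a a) (≤-trans (⇨-eval a ⊥ᴬ) (⊥-min b))))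

  θ-isDMBIEmbedding : IsDMBIEmbedding
  θ-isDMBIEmbedding = record
    { θ-up = λ a F⊑G a∈F → F⊑G a∈F
    ; θ-inj = θ-injective
    ; θ-⊤ = θ-⊤ᴬ
    ; θ-⊥ = θ-⊥ᴬ
    ; θ-∧ = θ-∧
    ; θ-∨ = θ-∨
    ; θ-⇨ = θ-⇨
    ; θ-* = θ-* {_≼_ = _⊑_} (λ x → x) (λ F⊑G → F⊑G)
    ; θ--* = θ--* {_≼_ = _⊑_} (λ x → x) (λ F⊑G → F⊑G)
    ; θ-⊤* = θ-⊤*
    ; θ-⊥* = θ-⊥*
    }

  θ-isCBIEmbedding : IsCBI 𝔸 → IsCBIEmbedding
  θ-isCBIEmbedding boolean = record
    { θ-inj = θ-injective
    ; θ-⊤ = θ-⊤ᴬ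
    ; θ-⊥ = θ-⊥ᴬ
    ; θ-∧ = θ-∧
    ; θ-∨ = θ-∨
    ; θ-⇨ = θ-⇨-Boolean boolean
    ; θ-* = θ-* {_≼_ = _≈F_} (λ {F} → (λ x → x) , (λ x → x)) proj₁
    ; θ--* = θ--* {_≼_ = _≈F_} (λ {F} → (λ x → x) , (λ x → x)) proj₁
    ; θ-⊤* = θ-⊤*
    ; θ-⊥* = θ-⊥*
    }

theorem6p10 : ({ℓ' : Level} → ExcludedMiddle ℓ') →
    ∀ {ℓ} → PrimeFilterTheorem ℓ → (𝔸 : DMBIAlgebra ℓ) →
      PrimeFilterFrame.IsDMBIEmbedding 𝔸
        × (IsCBI 𝔸 → PrimeFilterFrame.IsCBIEmbedding 𝔸)
theorem6p10 em pft 𝔸 = θ-isDMBIEmbedding , θ-isCBIEmbedding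
  where open Representation (em⇒dne em) pft 𝔸
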